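{- If $G_1,\ldots,G_r$, $r\ge 1$, are uniform geodesic graphs, then $${\rm gpack}(G_1\,\square\, \cdots \,\square\, G_r) \le \left\lfloor \frac{n(G_1)\cdots n(G_r)}{{\rm diam}(G_1) + \cdots +{\rm diam}(G_r) + 1} \right\rfloor.$$
   Context: Graphs are finite, simple and connected; $n(G)$ is the order and ${\rm diam}(G)$ the diameter of $G$. A geodesic is a shortest path; it is maximal if it is not contained as a subpath in any other geodesic. A graph $G$ is uniform geodesic if every maximal geodesic in $G$ has length ${\rm diam}(G)$. A geodesic packing of $G$ is a set of pairwise vertex-disjoint maximal geodesics, and ${\rm gpack}(G)$ is its maximum cardinality. The Cartesian product $G\,\square\,H$ has vertex set $V(G)\times V(H)$, with $(g,h)$ adjacent to $(g',h')$ iff either $g=g'$ and $hh'\in E(H)$, or $h=h'$ and $gg'\in E(G)$. -}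

module Defs where

open import Data.Nat using (ℕ; zero; suc; _+_; _*_; _≤_; _<_)
open import Data.Fin using (Fin)
open import Data.Fin.Properties using (*↔×)
open import Data.Product using (Σ; ∃; ∃-syntax; _×_; _,_; proj₁; proj₂)
open import Data.Product.Function.NonDependent.Propositional using (_×-↔_)
open import Data.Sum using (_⊎_; inj₁; inj₂)
open import Data.List using (List; length)
open import Data.List.Relation.Unary.All using (All)
open import Data.List.Relation.Unary.AllPairs using (AllPairs)
open import Data.Vec using (Vec; []; _∷_)
open import Function.Bundles using (_↔_)
open import Function.Properties.Inverse using (↔-trans)
open import Relation.Nullary using (¬_)
open import Relation.Binary.PropositionalEquality using (_≡_; _≢_)

-- The vertex set is a type V together with a
-- bijection Fin n ↔ V, so n is the order n(G).

record Graph : Set₁ where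
  field
    V     : Set
    n     : ℕ
    enum  : Fin n ↔ V
    Adj   : V → V → Set
    irrefl : ∀ {u} → ¬ Adj u u
    sym    : ∀ {u v} → Adj u v → Adj v u

open Graph public

order : Graph → ℕ
order = Graph.n

-- Walks.  A walk of length ℓ (number of edges) is given by its length
-- and its vertex sequence p 0, p 1, …, p ℓ (values beyond ℓ irrelevant).

record Walk (G : Graph) : Set where
  constructor walk
  field
    len  : ℕ
    vtx  : ℕ → V G
    adj  : ∀ i → i < len → Adj G (vtx i) (vtx (suc i))

open Walk public

Joins : ∀ {G} → Walk G → V G → V G → Set
Joins w u v = vtx w 0 ≡ u × vtx w (len w) ≡ v

Connected : Graph → Set
Connected G = ∀ (u v : V G) → Σ (Walk G) λ w → Joins w u v

Dist : (G : Graph) → V G → V G → ℕ → Set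
Dist G u v d =
  (Σ (Walk G) λ w → Joins w u v × len w ≡ d)
  × (∀ (w : Walk G) → Joins w u v → d ≤ len w)

IsDiam : Graph → ℕ → Set
IsDiam G D =
  (∀ u v d → Dist G u v d → d ≤ D)
  × (Σ (V G) λ u → Σ (V G) λ v → Dist G u v D)

-- A geodesic is a shortest path: a walk whose length equals the
-- distance between its end vertices (such a walk is automatically a path).
Geodesic : (G : Graph) → Walk G → Set
Geodesic G w = Dist G (vtx w 0) (vtx w (len w)) (len w)

-- P is a subpath of Q : the vertex sequence of P occurs as a
-- consecutive segment of that of Q.  (Since the reverse of a geodesic is
-- a geodesic, also allowing reversed occurrence gives the same notion of
-- maximality below.)
SubWalk : ∀ {G} → Walk G → Walk G → Set
SubWalk P Q =
  Σ ℕ λ o → (o + len P ≤ len Q) × (∀ i → i ≤ len P → vtx Q (o + i) ≡ vtx P i)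

MaximalGeodesic : (G : Graph) → Walk G → Set
MaximalGeodesic G P =
  Geodesic G P ×
  (∀ (Q : Walk G) → Geodesic G Q → SubWalk P Q → len Q ≤ len P)

UniformGeodesic : Graph → Set
UniformGeodesic G =
  ∀ D → IsDiam G D → ∀ (P : Walk G) → MaximalGeodesic G P → len P ≡ D

Disjoint : ∀ {G} → Walk G → Walk G → Set
Disjoint P Q = ∀ i j → i ≤ len P → j ≤ len Q → vtx P i ≢ vtx Q j

-- A geodesic packing: a list of pairwise vertex-disjoint maximal
-- geodesics; its cardinality is the length of the list (pairwise
-- disjointness forces the entries to be distinct).
GeodesicPacking : (G : Graph) → List (Walk G) → Set
GeodesicPacking G Ps = All (MaximalGeodesic G) Ps × AllPairs Disjoint Ps

IsGpack : Graph → ℕ → Set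
IsGpack G k =
  (Σ (List (Walk G)) λ Ps → GeodesicPacking G Ps × length Ps ≡ k)
  × (∀ Ps → GeodesicPacking G Ps → length Ps ≤ k)

data □Adj (G H : Graph) : V G × V H → V G × V H → Set where
  left  : ∀ {g g' h} → Adj G g g' → □Adj G H (g , h) (g' , h)
  right : ∀ {g h h'} → Adj H h h' → □Adj G H (g , h) (g , h')

□irrefl : ∀ {G H x} → ¬ □Adj G H x x
□irrefl {G} (left a)  = Graph.irrefl G a
□irrefl {H = H} (right a) = Graph.irrefl H a

□sym : ∀ {G H x y} → □Adj G H x y → □Adj G H y x
□sym {G} (left a)  = left (Graph.sym G a)
□sym {H = H} (right a) = right (Graph.sym H a)

_□_ : Graph → Graph → Graph
G □ H = record
  { V      = V G × V H
  ; n      = n G * n H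
  ; enum   = ↔-trans *↔× (enum G ×-↔ enum H)
  ; Adj    = □Adj G H
  ; irrefl = □irrefl
  ; sym    = □sym
  }
infixr 6 _□_

□ⁿ : ∀ {r} → Vec Graph (suc r) → Graph
□ⁿ (G ∷ [])     = G
□ⁿ (G ∷ H ∷ Gs) = G □ □ⁿ (H ∷ Gs)

prodOrder : ∀ {r} → Vec Graph r → ℕ
prodOrder []       = 1
prodOrder (G ∷ Gs) = n G * prodOrder Gs

sumℕ : ∀ {r} → Vec ℕ r → ℕ
sumℕ []       = 0
sumℕ (x ∷ xs) = x + sumℕ xs

-- A geodesic is maximal exactly when it cannot be prolonged by one edge at
-- either end to a longer geodesic.  A shortest walk in G □ H projects to
-- shortest walks in G and H whose lengths add up to its own, and distances
-- in G □ H are sums of distances in the factors; hence a prolongation of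
-- either projection lifts to a prolongation of the walk itself, and the
-- projections of a maximal geodesic are maximal.  As every maximal geodesic
-- of G_i has length diam(G_i), by induction on r every maximal geodesic of
-- G₁ □ ⋯ □ G_r has exactly diam(G₁) + ⋯ + diam(G_r) + 1 vertices, pairwise
-- distinct, and the geodesics of a packing are vertex-disjoint.
module Submission where

open import Defs hiding (sym)
open import Data.Nat using (ℕ; zero; suc; _+_; _*_; _≤_; _<_; _≤′_; ≤′-refl; ≤′-step; z≤n; s≤s; _/_; NonZero)
open import Data.Nat.Properties
open import Data.Nat.DivMod using (/-monoˡ-≤; m*n/n≡m)
open import Data.Fin as Fin using (Fin; toℕ) renaming (zero to fzero; suc to fsuc)
open import Data.Fin.Properties using (toℕ-injective; toℕ≤pred[n]; injective⇒≤; *↔×)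
import Data.Fin.Properties as Finₚ
open import Data.Vec using (Vec; []; _∷_; lookup)
open import Data.List as List using (List; length)
import Data.List.Relation.Unary.All as All
open import Data.List.Relation.Unary.AllPairs using (AllPairs; _∷_)
open import Data.List.Membership.Propositional.Properties using (∈-lookup)
open import Data.Product using (Σ; _×_; _,_; proj₁; proj₂)
open import Data.Sum using (_⊎_; inj₁; inj₂)
open import Data.Empty using (⊥-elim)
open import Function using (_∘_)
open import Function.Bundles using (Injection; mk↣)
open import Function.Construct.Composition using (_↣-∘_)
open import Function.Construct.Symmetry using (↔-sym)
open import Function.Properties.Inverse using (↔⇒↣)
open import Relation.Nullary using (¬_)
open import Relation.Binary using (tri<; tri≈; tri>)
open import Relation.Binary.PropositionalEquality
  using (_≡_; _≢_; refl; sym; trans; cong; cong₂; subst; module ≡-Reasoning)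

data IWalk (G : Graph) : V G → V G → Set where
  nil  : ∀ u → IWalk G u u
  cons : ∀ {u v w} → Adj G u v → IWalk G v w → IWalk G u w

module _ {G : Graph} where

  ilen : ∀ {u v} → IWalk G u v → ℕ
  ilen (nil _)    = 0
  ilen (cons _ p) = suc (ilen p)

  -- The first clause makes ivtx p 0 reduce to the start vertex.
  ivtx : ∀ {u v} → IWalk G u v → ℕ → V G
  ivtx {u} _ zero         = u
  ivtx (nil u) (suc _)    = u
  ivtx (cons _ p) (suc i) = ivtx p i

  ivtx-end : ∀ {u v} (p : IWalk G u v) → ivtx p (ilen p) ≡ v
  ivtx-end (nil _)    = refl
  ivtx-end (cons _ p) = ivtx-end p

  iadj : ∀ {u v} (p : IWalk G u v) i → i < ilen p → Adj G (ivtx p i) (ivtx p (suc i))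
  iadj (cons a _) zero    _          = a
  iadj (cons _ p) (suc i) (s≤s i<ℓ) = iadj p i i<ℓ

  toWalk : ∀ {u v} → IWalk G u v → Walk G
  toWalk p = walk (ilen p) (ivtx p) (iadj p)

  _++ᵢ_ : ∀ {u v w} → IWalk G u v → IWalk G v w → IWalk G u w
  nil _    ++ᵢ q = q
  cons a p ++ᵢ q = cons a (p ++ᵢ q)
  infixr 5 _++ᵢ_

  ++ᵢ-length : ∀ {u v w} (p : IWalk G u v) (q : IWalk G v w) → ilen (p ++ᵢ q) ≡ ilen p + ilen q
  ++ᵢ-length (nil _)    q = refl
  ++ᵢ-length (cons _ p) q = cong suc (++ᵢ-length p q)

  _▷_ : ∀ {u v w} → IWalk G u v → Adj G v w → IWalk G u w
  nil _    ▷ a = cons a (nil _)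
  cons b p ▷ a = cons b (p ▷ a)

  ▷-length : ∀ {u v w} (p : IWalk G u v) (a : Adj G v w) → ilen (p ▷ a) ≡ suc (ilen p)
  ▷-length (nil _)    a = refl
  ▷-length (cons _ p) a = cong suc (▷-length p a)

  ▷-vtx : ∀ {u v w} (p : IWalk G u v) (a : Adj G v w) i → i ≤ ilen p → ivtx (p ▷ a) i ≡ ivtx p i
  ▷-vtx p          a zero    _          = refl
  ▷-vtx (cons _ p) a (suc i) (s≤s i≤ℓ) = ▷-vtx p a i i≤ℓ

  castᵢ : ∀ {u u′ v v′} → u ≡ u′ → v ≡ v′ → IWalk G u v → IWalk G u′ v′
  castᵢ refl refl p = p

  castᵢ-length : ∀ {u u′ v v′} (eu : u ≡ u′) (ev : v ≡ v′) (p : IWalk G u v) → ilen (castᵢ eu ev p) ≡ ilen p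
  castᵢ-length refl refl p = refl

  segment : (w : Walk G) {i j : ℕ} → i ≤′ j → j ≤ len w → IWalk G (vtx w i) (vtx w j)
  segment w ≤′-refl              _   = nil _
  segment w (≤′-step {j} i≤′j) j<ℓ = segment w i≤′j (<⇒≤ j<ℓ) ▷ adj w j j<ℓ

  segment-length : (w : Walk G) {i j : ℕ} (i≤′j : i ≤′ j) (j≤ℓ : j ≤ len w) → i + ilen (segment w i≤′j j≤ℓ) ≡ j
  segment-length w {i} ≤′-refl _ = +-identityʳ i
  segment-length w {i} (≤′-step {j} i≤′j) j<ℓ = begin
    i + ilen (segment w i≤′j _ ▷ adj w j j<ℓ) ≡⟨ cong (i +_) (▷-length _ _) ⟩
    i + suc (ilen (segment w i≤′j _))        ≡⟨ +-suc i _ ⟩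
    suc (i + ilen (segment w i≤′j _))        ≡⟨ cong suc (segment-length w i≤′j _) ⟩
    suc j                                     ∎
    where open ≡-Reasoning

  segment-vtx : (w : Walk G) {i j : ℕ} (i≤′j : i ≤′ j) (j≤ℓ : j ≤ len w)
    → ∀ k → k ≤ ilen (segment w i≤′j j≤ℓ) → ivtx (segment w i≤′j j≤ℓ) k ≡ vtx w (i + k)
  segment-vtx w {i} ≤′-refl _ zero z≤n = cong (vtx w) (sym (+-identityʳ i))
  segment-vtx w {i} (≤′-step {j} i≤′j) j<ℓ k k≤ℓ
    with m≤n⇒m<n∨m≡n (subst (k ≤_) (▷-length (segment w i≤′j _) (adj w j j<ℓ)) k≤ℓ)
  ... | inj₁ (s≤s k≤ℓ′) = trans (▷-vtx _ _ k k≤ℓ′) (segment-vtx w i≤′j _ k k≤ℓ′)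
  ... | inj₂ refl = begin
    ivtx (s ▷ a) (suc (ilen s)) ≡⟨ cong (ivtx (s ▷ a)) (sym (▷-length s a)) ⟩
    ivtx (s ▷ a) (ilen (s ▷ a)) ≡⟨ ivtx-end (s ▷ a) ⟩
    vtx w (suc j)               ≡⟨ cong (vtx w) (sym (segment-length w (≤′-step i≤′j) j<ℓ)) ⟩
    vtx w (i + ilen (s ▷ a))    ≡⟨ cong (vtx w ∘ (i +_)) (▷-length s a) ⟩
    vtx w (i + suc (ilen s))    ∎
    where
    open ≡-Reasoning
    s = segment w i≤′j (<⇒≤ j<ℓ)
    a = adj w j j<ℓ

  fromWalk : (w : Walk G) → IWalk G (vtx w 0) (vtx w (len w))
  fromWalk w = segment w (≤⇒≤′ z≤n) ≤-refl

  fromWalk-length : (w : Walk G) → ilen (fromWalk w) ≡ len w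
  fromWalk-length w = segment-length w (≤⇒≤′ z≤n) ≤-refl

  fromWalk-vtx : (w : Walk G) → ∀ i → i ≤ len w → ivtx (fromWalk w) i ≡ vtx w i
  fromWalk-vtx w i i≤ℓ = segment-vtx w (≤⇒≤′ z≤n) ≤-refl i (subst (i ≤_) (sym (fromWalk-length w)) i≤ℓ)

DistAtLeast : (G : Graph) → V G → V G → ℕ → Set
DistAtLeast G u v d = ∀ (q : IWalk G u v) → d ≤ ilen q

module _ {G : Graph} where

  geodesic⇒distAtLeast : (P : Walk G) → Geodesic G P → DistAtLeast G (vtx P 0) (vtx P (len P)) (len P)
  geodesic⇒distAtLeast P (_ , shortest) q = shortest (toWalk q) (refl , ivtx-end q)

  distAtLeast⇒geodesic : ∀ {u v} (p : IWalk G u v) → DistAtLeast G u v (ilen p) → Geodesic G (toWalk p)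
  distAtLeast⇒geodesic p d = (toWalk p , (refl , refl) , refl) , shortest
    where
    shortest : ∀ w → Joins w (ivtx p 0) (ivtx p (ilen p)) → ilen p ≤ len w
    shortest w (w₀ , wℓ) = subst (ilen p ≤_) (trans (castᵢ-length _ _ _) (fromWalk-length w))
      (d (castᵢ w₀ (trans wℓ (ivtx-end p)) (fromWalk w)))

  -- Splicing q into Q in place of its part between i and j gives a walk
  -- no shorter than Q.
  geodesic-segment-shortest : (Q : Walk G) → Geodesic G Q → ∀ {i j} (i≤′j : i ≤′ j) → j ≤ len Q
    → (q : IWalk G (vtx Q i) (vtx Q j)) → j ≤ i + ilen q
  geodesic-segment-shortest Q geo {i} {j} i≤′j j≤ℓ q = +-cancelʳ-≤ (ilen suffix) j (i + ilen q) (begin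
    j + ilen suffix                         ≡⟨ segment-length Q (≤⇒≤′ j≤ℓ) ≤-refl ⟩
    len Q                                   ≤⟨ geodesic⇒distAtLeast Q geo (prefix ++ᵢ q ++ᵢ suffix) ⟩
    ilen (prefix ++ᵢ q ++ᵢ suffix)          ≡⟨ ++ᵢ-length prefix (q ++ᵢ suffix) ⟩
    ilen prefix + ilen (q ++ᵢ suffix)       ≡⟨ cong₂ _+_ (segment-length Q (≤⇒≤′ z≤n) _) (++ᵢ-length q suffix) ⟩
    i + (ilen q + ilen suffix)              ≡⟨ +-assoc i (ilen q) (ilen suffix) ⟨
    i + ilen q + ilen suffix                ∎)
    where
    open ≤-Reasoning
    prefix = segment Q (≤⇒≤′ z≤n) (≤-trans (≤′⇒≤ i≤′j) j≤ℓ)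
    suffix = segment Q (≤⇒≤′ j≤ℓ) ≤-refl

  geodesic-vertices-distinct : (P : Walk G) → Geodesic G P
    → ∀ {i j} → i < j → j ≤ len P → vtx P i ≢ vtx P j
  geodesic-vertices-distinct P geo {i} i<j j≤ℓ e = <⇒≱ i<j (begin
    _                                ≤⟨ geodesic-segment-shortest P geo (≤⇒≤′ (<⇒≤ i<j)) j≤ℓ loop ⟩
    i + ilen loop                    ≡⟨ cong (i +_) (castᵢ-length refl e (nil _)) ⟩
    i + 0                            ≡⟨ +-identityʳ i ⟩
    i                                ∎)
    where
    open ≤-Reasoning
    loop = castᵢ refl e (nil _)

  geodesic-injective : (P : Walk G) → Geodesic G P
    → ∀ {i j} → i ≤ len P → j ≤ len P → vtx P i ≡ vtx P j → i ≡ j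
  geodesic-injective P geo {i} {j} i≤ℓ j≤ℓ e with <-cmp i j
  ... | tri< i<j _ _ = ⊥-elim (geodesic-vertices-distinct P geo i<j j≤ℓ e)
  ... | tri≈ _ i≡j _ = i≡j
  ... | tri> _ _ j<i = ⊥-elim (geodesic-vertices-distinct P geo j<i i≤ℓ (sym e))

Prolongation : (G : Graph) → V G → V G → ℕ → Set
Prolongation G u v ℓ =
    (Σ (V G) λ z → Adj G v z × DistAtLeast G u z (suc ℓ))
  ⊎ (Σ (V G) λ z → Adj G z u × DistAtLeast G z v (suc ℓ))

module _ {G : Graph} where

  longer-supergeodesic⇒prolongation : (P Q : Walk G) → Geodesic G Q → SubWalk P Q → len P < len Q
    → Prolongation G (vtx P 0) (vtx P (len P)) (len P)
  longer-supergeodesic⇒prolongation P Q geo (zero , _ , onQ) ℓ<ℓQ =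
    inj₁ (vtx Q (suc ℓ) , subst (λ v → Adj G v (vtx Q (suc ℓ))) (onQ ℓ ≤-refl) (adj Q ℓ ℓ<ℓQ) , far)
    where
    ℓ = len P
    far : DistAtLeast G (vtx P 0) (vtx Q (suc ℓ)) (suc ℓ)
    far q = subst (suc ℓ ≤_) (castᵢ-length _ refl q)
      (geodesic-segment-shortest Q geo (≤⇒≤′ z≤n) ℓ<ℓQ (castᵢ (sym (onQ 0 z≤n)) refl q))
  longer-supergeodesic⇒prolongation P Q geo (suc o , o+ℓ<ℓQ , onQ) _ =
    inj₂ (vtx Q o , subst (Adj G (vtx Q o)) Q[o+1]≡P[0] (adj Q o o<ℓQ) , far)
    where
    ℓ = len P
    o<ℓQ : o < len Q
    o<ℓQ = ≤-trans (s≤s (m≤m+n o ℓ)) o+ℓ<ℓQ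
    Q[o+1]≡P[0] : vtx Q (suc o) ≡ vtx P 0
    Q[o+1]≡P[0] = trans (cong (vtx Q ∘ suc) (sym (+-identityʳ o))) (onQ 0 z≤n)
    far : DistAtLeast G (vtx Q o) (vtx P ℓ) (suc ℓ)
    far q = +-cancelˡ-≤ o (suc ℓ) (ilen q) (begin
      o + suc ℓ                ≡⟨ +-suc o ℓ ⟩
      suc (o + ℓ)              ≤⟨ geodesic-segment-shortest Q geo (≤⇒≤′ (m≤n⇒m≤1+n (m≤m+n o ℓ))) o+ℓ<ℓQ q′ ⟩
      o + ilen q′              ≡⟨ cong (o +_) (castᵢ-length refl _ q) ⟩
      o + ilen q               ∎)
      where
      open ≤-Reasoning
      q′ = castᵢ refl (sym (onQ ℓ ≤-refl)) q

  maximal-not-in-longer : (P : Walk G) → MaximalGeodesic G P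
    → ∀ {u v} (q : IWalk G u v) → ilen q ≡ suc (len P) → DistAtLeast G u v (suc (len P))
    → ¬ SubWalk P (toWalk q)
  maximal-not-in-longer P (_ , maximal) q ℓq≡ far sub =
    1+n≰n (subst (_≤ len P) ℓq≡ (maximal (toWalk q) geo sub))
    where
    geo = distAtLeast⇒geodesic q (subst (DistAtLeast G _ _) (sym ℓq≡) far)

  maximal⇒¬prolongation : (P : Walk G) → MaximalGeodesic G P
    → ¬ Prolongation G (vtx P 0) (vtx P (len P)) (len P)
  maximal⇒¬prolongation P max (inj₁ (_ , e , far)) =
    maximal-not-in-longer P max (fromWalk P ▷ e) ℓ≡ far (0 , ≤-trans (n≤1+n _) (≤-reflexive (sym ℓ≡)) , onP)
    where
    ℓ≡ : ilen (fromWalk P ▷ e) ≡ suc (len P)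
    ℓ≡ = trans (▷-length _ e) (cong suc (fromWalk-length P))
    onP : ∀ i → i ≤ len P → ivtx (fromWalk P ▷ e) i ≡ vtx P i
    onP i i≤ℓ = trans (▷-vtx _ e i (subst (i ≤_) (sym (fromWalk-length P)) i≤ℓ)) (fromWalk-vtx P i i≤ℓ)
  maximal⇒¬prolongation P max (inj₂ (_ , e , far)) =
    maximal-not-in-longer P max (cons e (fromWalk P)) ℓ≡ far (1 , ≤-reflexive (sym ℓ≡) , fromWalk-vtx P)
    where
    ℓ≡ : ilen (cons e (fromWalk P)) ≡ suc (len P)
    ℓ≡ = cong suc (fromWalk-length P)

  ¬prolongation⇒maximal : ∀ {u v} (p : IWalk G u v) → DistAtLeast G u v (ilen p)
    → ¬ Prolongation G u v (ilen p) → MaximalGeodesic G (toWalk p)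
  ¬prolongation⇒maximal {u} p short stuck = distAtLeast⇒geodesic p short , λ Q geo sub →
    ≮⇒≥ λ ℓ<ℓQ → stuck (subst (λ v → Prolongation G u v (ilen p)) (ivtx-end p)
      (longer-supergeodesic⇒prolongation (toWalk p) Q geo sub ℓ<ℓQ))

module _ {G H : Graph} where

  projˡ : ∀ {x y} → IWalk (G □ H) x y → IWalk G (proj₁ x) (proj₁ y)
  projˡ (nil _)            = nil _
  projˡ (cons (left a) p)  = cons a (projˡ p)
  projˡ (cons (right _) p) = projˡ p

  projʳ : ∀ {x y} → IWalk (G □ H) x y → IWalk H (proj₂ x) (proj₂ y)
  projʳ (nil _)            = nil _
  projʳ (cons (left _) p)  = projʳ p
  projʳ (cons (right a) p) = cons a (projʳ p)

  ilen-proj : ∀ {x y} (p : IWalk (G □ H) x y) → ilen p ≡ ilen (projˡ p) + ilen (projʳ p)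
  ilen-proj (nil _)            = refl
  ilen-proj (cons (left _) p)  = cong suc (ilen-proj p)
  ilen-proj (cons (right _) p) = trans (cong suc (ilen-proj p)) (sym (+-suc _ _))

  liftˡ : ∀ {g g′} → IWalk G g g′ → ∀ h → IWalk (G □ H) (g , h) (g′ , h)
  liftˡ (nil _)    h = nil _
  liftˡ (cons a p) h = cons (left a) (liftˡ p h)

  liftʳ : ∀ {h h′} → IWalk H h h′ → ∀ g → IWalk (G □ H) (g , h) (g , h′)
  liftʳ (nil _)    g = nil _
  liftʳ (cons a p) g = cons (right a) (liftʳ p g)

  ilen-liftˡ : ∀ {g g′} (p : IWalk G g g′) h → ilen (liftˡ p h) ≡ ilen p
  ilen-liftˡ (nil _)    h = refl
  ilen-liftˡ (cons _ p) h = cong suc (ilen-liftˡ p h)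

  ilen-liftʳ : ∀ {h h′} (p : IWalk H h h′) g → ilen (liftʳ p g) ≡ ilen p
  ilen-liftʳ (nil _)    g = refl
  ilen-liftʳ (cons _ p) g = cong suc (ilen-liftʳ p g)

  □-distAtLeast : ∀ {g g′ h h′ a b} → DistAtLeast G g g′ a → DistAtLeast H h h′ b
    → DistAtLeast (G □ H) (g , h) (g′ , h′) (a + b)
  □-distAtLeast farG farH q =
    subst (_ ≤_) (sym (ilen-proj q)) (+-mono-≤ (farG (projˡ q)) (farH (projʳ q)))

  -- Any shorter walk in a factor would combine with the other projection
  -- into a shorter walk in G □ H.
  projˡ-distAtLeast : ∀ {x y} (p : IWalk (G □ H) x y) → DistAtLeast (G □ H) x y (ilen p)
    → DistAtLeast G (proj₁ x) (proj₁ y) (ilen (projˡ p))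
  projˡ-distAtLeast {x} {y} p short q = +-cancelʳ-≤ (ilen (projʳ p)) _ _ (begin
    ilen (projˡ p) + ilen (projʳ p) ≡⟨ ilen-proj p ⟨
    ilen p                          ≤⟨ short (liftˡ q (proj₂ x) ++ᵢ liftʳ (projʳ p) (proj₁ y)) ⟩
    ilen (liftˡ q _ ++ᵢ liftʳ (projʳ p) _) ≡⟨ ++ᵢ-length (liftˡ q _) _ ⟩
    ilen (liftˡ q _) + ilen (liftʳ (projʳ p) _) ≡⟨ cong₂ _+_ (ilen-liftˡ q _) (ilen-liftʳ (projʳ p) _) ⟩
    ilen q + ilen (projʳ p)         ∎)
    where open ≤-Reasoning

  projʳ-distAtLeast : ∀ {x y} (p : IWalk (G □ H) x y) → DistAtLeast (G □ H) x y (ilen p)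
    → DistAtLeast H (proj₂ x) (proj₂ y) (ilen (projʳ p))
  projʳ-distAtLeast {x} {y} p short q = +-cancelˡ-≤ (ilen (projˡ p)) _ _ (begin
    ilen (projˡ p) + ilen (projʳ p) ≡⟨ ilen-proj p ⟨
    ilen p                          ≤⟨ short (liftˡ (projˡ p) (proj₂ x) ++ᵢ liftʳ q (proj₁ y)) ⟩
    ilen (liftˡ (projˡ p) _ ++ᵢ liftʳ q _) ≡⟨ ++ᵢ-length (liftˡ (projˡ p) _) _ ⟩
    ilen (liftˡ (projˡ p) _) + ilen (liftʳ q _) ≡⟨ cong₂ _+_ (ilen-liftˡ (projˡ p) _) (ilen-liftʳ q _) ⟩
    ilen (projˡ p) + ilen q         ∎)
    where open ≤-Reasoning

  □-prolongationˡ : ∀ {g g′ h h′ a b} → DistAtLeast H h h′ b → Prolongation G g g′ a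
    → Prolongation (G □ H) (g , h) (g′ , h′) (a + b)
  □-prolongationˡ farH (inj₁ (_ , e , far)) = inj₁ (_ , left e , □-distAtLeast far farH)
  □-prolongationˡ farH (inj₂ (_ , e , far)) = inj₂ (_ , left e , □-distAtLeast far farH)

  □-prolongationʳ : ∀ {g g′ h h′ a b} → DistAtLeast G g g′ a → Prolongation H h h′ b
    → Prolongation (G □ H) (g , h) (g′ , h′) (a + b)
  □-prolongationʳ {a = a} {b} farG (inj₁ (_ , e , far)) =
    inj₁ (_ , right e , subst (DistAtLeast (G □ H) _ _) (+-suc a b) (□-distAtLeast farG far))
  □-prolongationʳ {a = a} {b} farG (inj₂ (_ , e , far)) =
    inj₂ (_ , right e , subst (DistAtLeast (G □ H) _ _) (+-suc a b) (□-distAtLeast farG far))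

MaximalGeodesicLength : Graph → ℕ → Set
MaximalGeodesicLength G ℓ = ∀ P → MaximalGeodesic G P → len P ≡ ℓ

□-maximalGeodesicLength : ∀ {G H a b} → MaximalGeodesicLength G a → MaximalGeodesicLength H b
  → MaximalGeodesicLength (G □ H) (a + b)
□-maximalGeodesicLength {G} {H} {a} {b} lenG lenH P max = begin
  len P                           ≡⟨ fromWalk-length P ⟨
  ilen p                          ≡⟨ ilen-proj p ⟩
  ilen (projˡ p) + ilen (projʳ p) ≡⟨ cong₂ _+_ (lenG (toWalk (projˡ p)) maxˡ) (lenH (toWalk (projʳ p)) maxʳ) ⟩
  a + b                           ∎
  where
  open ≡-Reasoning
  p = fromWalk P
  short : DistAtLeast (G □ H) (vtx P 0) (vtx P (len P)) (ilen p)
  short = subst (DistAtLeast (G □ H) _ _) (sym (fromWalk-length P)) (geodesic⇒distAtLeast P (proj₁ max))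
  stuck : ¬ Prolongation (G □ H) (vtx P 0) (vtx P (len P)) (ilen (projˡ p) + ilen (projʳ p))
  stuck = maximal⇒¬prolongation P max
        ∘ subst (Prolongation (G □ H) _ _) (trans (sym (ilen-proj p)) (fromWalk-length P))
  maxˡ : MaximalGeodesic G (toWalk (projˡ p))
  maxˡ = ¬prolongation⇒maximal (projˡ p) (projˡ-distAtLeast p short)
           (stuck ∘ □-prolongationˡ (projʳ-distAtLeast p short))
  maxʳ : MaximalGeodesic H (toWalk (projʳ p))
  maxʳ = ¬prolongation⇒maximal (projʳ p) (projʳ-distAtLeast p short)
           (stuck ∘ □-prolongationʳ (projˡ-distAtLeast p short))

□ⁿ-maximalGeodesicLength : ∀ {r} (Gs : Vec Graph (suc r)) (Ds : Vec ℕ (suc r))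
  → (∀ i → MaximalGeodesicLength (lookup Gs i) (lookup Ds i))
  → MaximalGeodesicLength (□ⁿ Gs) (sumℕ Ds)
□ⁿ-maximalGeodesicLength (_ ∷ [])     (D ∷ [])  lens P max = trans (lens fzero P max) (sym (+-identityʳ D))
□ⁿ-maximalGeodesicLength (G ∷ H ∷ Gs) (D ∷ Ds) lens =
  □-maximalGeodesicLength (lens fzero) (□ⁿ-maximalGeodesicLength (H ∷ Gs) Ds (lens ∘ fsuc))

order-□ⁿ : ∀ {r} (Gs : Vec Graph (suc r)) → n (□ⁿ Gs) ≡ prodOrder Gs
order-□ⁿ (G ∷ [])     = sym (*-identityʳ (n G))
order-□ⁿ (G ∷ H ∷ Gs) = cong (n G *_) (order-□ⁿ (H ∷ Gs))

AllPairs-lookup : ∀ {A : Set} {R : A → A → Set} {xs : List A} → AllPairs R xs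
  → ∀ {i j : Fin (length xs)} → i Fin.< j → R (List.lookup xs i) (List.lookup xs j)
AllPairs-lookup (rs ∷ _)  {fzero}  {fsuc j} _         = All.lookup rs (∈-lookup j)
AllPairs-lookup (_ ∷ rss) {fsuc i} {fsuc j} (s≤s i<j) = AllPairs-lookup rss i<j

packing-bound : ∀ {G ℓ Ps} → MaximalGeodesicLength G ℓ → GeodesicPacking G Ps → length Ps * suc ℓ ≤ n G
packing-bound {G} {ℓ} {Ps} lenG (maxs , disjoint) =
  injective⇒≤ (Injection.injective ((↔⇒↣ (↔-sym (enum G)) ↣-∘ mk↣ at-injective) ↣-∘ ↔⇒↣ *↔×))
  where
  at : Fin (length Ps) × Fin (suc ℓ) → V G
  at (i , j) = vtx (List.lookup Ps i) (toℕ j)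
  maximal : ∀ i → MaximalGeodesic G (List.lookup Ps i)
  maximal i = All.lookup maxs (∈-lookup i)
  bound : ∀ i (j : Fin (suc ℓ)) → toℕ j ≤ len (List.lookup Ps i)
  bound i j = subst (toℕ j ≤_) (sym (lenG (List.lookup Ps i) (maximal i))) (toℕ≤pred[n] j)
  at-injective : ∀ {x y} → at x ≡ at y → x ≡ y
  at-injective {i , j} {i′ , j′} e with Finₚ.<-cmp i i′
  ... | tri< i<i′ _ _ = ⊥-elim (AllPairs-lookup disjoint i<i′ (toℕ j) (toℕ j′) (bound i j) (bound i′ j′) e)
  ... | tri≈ _ refl _ = cong (i ,_) (toℕ-injective (geodesic-injective (List.lookup Ps i) (proj₁ (maximal i)) (bound i j) (bound i j′) e))
  ... | tri> _ _ i′<i = ⊥-elim (AllPairs-lookup disjoint i′<i (toℕ j′) (toℕ j) (bound i′ j′) (bound i j) (sym e))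

m*n≤o⇒m≤o/n : ∀ m n {o} .{{_ : NonZero n}} → m * n ≤ o → m ≤ o / n
m*n≤o⇒m≤o/n m n m*n≤o = subst (_≤ _) (m*n/n≡m m n) (/-monoˡ-≤ n m*n≤o)

corollary2p8 : (r : ℕ) (Gs : Vec Graph (suc r)) (Ds : Vec ℕ (suc r))
    → (∀ (i : Fin (suc r)) → Connected (lookup Gs i))
    → (∀ (i : Fin (suc r)) → IsDiam (lookup Gs i) (lookup Ds i))
    → (∀ (i : Fin (suc r)) → UniformGeodesic (lookup Gs i))
    → ∀ (k : ℕ) → IsGpack (□ⁿ Gs) k
    → k ≤ prodOrder Gs / (1 + sumℕ Ds)
corollary2p8 r Gs Ds _ diam uniform _ ((Ps , packing , refl) , _) =
  m*n≤o⇒m≤o/n (length Ps) (1 + sumℕ Ds)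
    (subst (length Ps * suc (sumℕ Ds) ≤_) (order-□ⁿ Gs)
      (packing-bound (□ⁿ-maximalGeodesicLength Gs Ds (λ i → uniform i _ (diam i))) packing))
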